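{- If $(f,C)$ is a low-defect pair with $\delta(f,C)<\deg f+1$, then $(f,C)$ is substantial.
   Context: $\|n\|$ denotes the integer complexity of $n\in\mathbb{N}$ (least number of $1$'s needed to write $n$ using $1$, $+$, $\cdot$ and parentheses). $n$ is stable if $\|3^kn\|=3k+\|n\|$ for all $k\ge0$; the stable complexity is $\|n\|_{\mathrm{st}}=\|3^kn\|-3k$ for any $k$ with $3^kn$ stable. Low-defect pairs: the smallest subset $\mathscr{P}$ of $\mathbb{Z}[x_1,x_2,\ldots]\times\mathbb{N}$ such that (i) $(k,C)\in\mathscr{P}$ for constant $k\in\mathbb{N}$ and $C\ge\|k\|$; (ii) $(f_1,C_1),(f_2,C_2)\in\mathscr{P}$ implies $(f_1\otimes f_2,C_1+C_2)\in\mathscr{P}$, where $f_1\otimes f_2$ is the product after relabeling variables to be disjoint; (iii) $(f,C)\in\mathscr{P}$, $c\in\mathbb{N}$, $D\ge\|c\|$ imply $(f\cdot x+c,C+D)\in\mathscr{P}$ with $x$ a new variable. A low-defect polynomial is multilinear, its degree equals its number of variables, and its leading coefficient (coefficient of the product of all variables) is nonzero. For a pair $(f,C)$ with leading coefficient $a$, $\delta(f,C)=C-3\log_3 a$, and $(f,C)$ is substantial if $C=\|a\|_{\mathrm{st}}+\deg f$. -}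

module Defs where

open import Data.Nat using (ℕ; zero; suc; _+_; _*_; _^_; _≤_; _<_)
open import Data.Bool using (Bool; true; false; not; _∧_; if_then_else_)
open import Data.Fin using (Fin; _↑ˡ_; _↑ʳ_)
import Data.Fin as Fin
open import Data.Product using (Σ; _×_; _,_)
open import Function using (_∘_)
open import Relation.Binary.PropositionalEquality using (_≡_; _≢_)

-- Integer complexity, following the definition: least number of 1's
-- in an expression built from 1, + and ·.

data Expr : Set where
  one : Expr
  _⊕_ : Expr → Expr → Expr
  _⊛_ : Expr → Expr → Expr

eval : Expr → ℕ
eval one = 1
eval (e ⊕ f) = eval e + eval f
eval (e ⊛ f) = eval e * eval f

ones : Expr → ℕ
ones one = 1
ones (e ⊕ f) = ones e + ones f
ones (e ⊛ f) = ones e + ones f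

IsCpx : ℕ → ℕ → Set
IsCpx n k = (Σ Expr λ e → eval e ≡ n × ones e ≡ k)
          × (∀ e → eval e ≡ n → k ≤ ones e)

-- CpxLE n C  means  ‖n‖ ≤ C  (in particular n ≥ 1).
CpxLE : ℕ → ℕ → Set
CpxLE n C = Σ ℕ λ c → IsCpx n c × c ≤ C

Stable : ℕ → Set
Stable n = ∀ k c → IsCpx n c → IsCpx (3 ^ k * n) (3 * k + c)

IsStCpx : ℕ → ℕ → Set
IsStCpx n s = Σ ℕ λ k → Stable (3 ^ k * n) × IsCpx (3 ^ k * n) (s + 3 * k)

-- Multilinear polynomials in the variables x₁,…,xₙ (indexed by Fin n),
-- with natural-number coefficients: a monomial is a subset of variables.

Mono : ℕ → Set
Mono n = Fin n → Bool

MPoly : ℕ → Set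
MPoly n = Mono n → ℕ

mdeg : ∀ {n} → Mono n → ℕ
mdeg {zero} m = 0
mdeg {suc n} m = (if m Fin.zero then 1 else 0) + mdeg (m ∘ Fin.suc)

isConstMono : ∀ {n} → Mono n → Bool
isConstMono {zero} m = true
isConstMono {suc n} m = not (m Fin.zero) ∧ isConstMono (m ∘ Fin.suc)

constP : ℕ → MPoly 0
constP k _ = k

_⊗_ : ∀ {n m} → MPoly n → MPoly m → MPoly (n + m)
_⊗_ {n} {m} f g mono = f (λ i → mono (i ↑ˡ m)) * g (λ j → mono (n ↑ʳ j))

-- f · x + c with x a new variable (placed at index 0, the others shifted)
_·x+_ : ∀ {n} → MPoly n → ℕ → MPoly (suc n)
(f ·x+ c) mono =
  if mono Fin.zero
  then f (mono ∘ Fin.suc)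
  else (if isConstMono (mono ∘ Fin.suc) then c else 0)

IsDegree : ∀ {n} → MPoly n → ℕ → Set
IsDegree {n} f d = (Σ (Mono n) λ m → f m ≢ 0 × mdeg m ≡ d)
                 × (∀ (m : Mono n) → f m ≢ 0 → mdeg m ≤ d)

lead : ∀ {n} → MPoly n → ℕ
lead f = f (λ _ → true)

data LowDefect : (n : ℕ) → MPoly n → ℕ → Set where
  ld-const  : ∀ k C → CpxLE k C → LowDefect 0 (constP k) C
  ld-tensor : ∀ {n m f g C D} → LowDefect n f C → LowDefect m g D →
              LowDefect (n + m) (f ⊗ g) (C + D)
  ld-add    : ∀ {n f C} c D → LowDefect n f C → CpxLE c D →
              LowDefect (suc n) (f ·x+ c) (C + D)

-- δ(f,C) < deg f + 1, where δ(f,C) = C - 3 log₃ a, a = lead f, d = deg f.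
-- Equivalently (exponentiating base 3): 3^C < a^3 · 3^(d+1).
DefectBelow : ∀ {n} → MPoly n → ℕ → ℕ → Set
DefectBelow f C d = 3 ^ C < lead f ^ 3 * 3 ^ (suc d)

Substantial : ∀ {n} → MPoly n → ℕ → ℕ → Set
Substantial f C d = Σ ℕ λ s → IsStCpx (lead f) s × C ≡ s + d

module Submission where

open import Defs
open import Data.Nat using (ℕ; zero; suc; _+_; _*_; _^_; _≤_; _<_; z≤n; s≤s; NonZero)
open import Data.Nat.Properties
open import Data.Nat.Tactic.RingSolver using (solve-∀)
open import Data.Bool using (true; false)
import Data.Fin as Fin
open import Data.Product using (Σ; _×_; _,_)
open import Function using (_∘_)
open import Relation.Binary.PropositionalEquality
open import Relation.Nullary using (yes; no; contradiction)
import Algebra.Properties.CommutativeSemigroup as CommSemigroupProps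
open CommSemigroupProps +-commutativeSemigroup using () renaming (interchange to +-interchange)
open CommSemigroupProps *-commutativeSemigroup using () renaming (interchange to *-interchange)

-- Every expression e satisfies (eval e)³ ≤ 3^(ones e), i.e. ‖m‖ ≥ 3 log₃ m.
-- Following the construction of a low-defect pair (f,C) yields an expression
-- for its leading coefficient a with at most C − deg f ones, while
-- δ(f,C) < deg f + 1 says that C − deg f exceeds 3 log₃ a by less than one.
-- Multiplying by 3^k adds exactly 3k on both sides, so ‖3^k a‖ = 3k + C − deg f
-- for every k: a is stable and ‖a‖_st = C − deg f.

1≤eval : ∀ e → 1 ≤ eval e
1≤eval one     = s≤s z≤n
1≤eval (e ⊕ f) = ≤-trans (1≤eval e) (m≤m+n (eval e) (eval f))
1≤eval (e ⊛ f) = *-mono-≤ (1≤eval e) (1≤eval f)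

1≤ones : ∀ e → 1 ≤ ones e
1≤ones one     = s≤s z≤n
1≤ones (e ⊕ f) = ≤-trans (1≤ones e) (m≤m+n (ones e) (ones f))
1≤ones (e ⊛ f) = ≤-trans (1≤ones e) (m≤m+n (ones e) (ones f))

^-distribʳ-* : ∀ m n o → (m * n) ^ o ≡ m ^ o * n ^ o
^-distribʳ-* m n zero    = refl
^-distribʳ-* m n (suc o) =
  trans (cong (m * n *_) (^-distribʳ-* m n o)) (*-interchange m n (m ^ o) (n ^ o))

^-cancelʳ-< : ∀ m .{{_ : NonZero m}} {i j} → m ^ i < m ^ j → i < j
^-cancelʳ-< m {i} {j} mⁱ<mʲ with i <? j
... | yes i<j = i<j
... | no  i≮j = contradiction (^-monoʳ-≤ m (≮⇒≥ i≮j)) (<⇒≱ mⁱ<mʲ)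

suc-cube≤3*cube : ∀ t → (4 + t) ^ 3 ≤ 3 * (3 + t) ^ 3
suc-cube≤3*cube t = ≤-trans (m≤m+n _ _) (≤-reflexive (sym (expand t)))
  where
  expand : ∀ t → 3 * ((3 + t) * ((3 + t) * ((3 + t) * 1)))
               ≡ (4 + t) * ((4 + t) * ((4 + t) * 1)) + (17 + 33 * t + 15 * (t * t) + 2 * (t * t * t))
  expand = solve-∀

suc-cube-bound : ∀ {y b} → 1 ≤ y → 1 ≤ b → y ^ 3 ≤ 3 ^ b → (1 + y) ^ 3 ≤ 3 ^ suc b
suc-cube-bound {1}                 _ 1≤b _ = ≤-trans (n≤1+n 8) (*-monoʳ-≤ 3 (^-monoʳ-≤ 3 1≤b))
suc-cube-bound {2} {1}             _ _ (s≤s (s≤s (s≤s ())))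
suc-cube-bound {2} {suc (suc b)}   _ _ _ = *-monoʳ-≤ 3 (^-monoʳ-≤ 3 {2} {2 + b} (s≤s (s≤s z≤n)))
suc-cube-bound {suc (suc (suc t))} _ _ y³≤3ᵇ = ≤-trans (suc-cube≤3*cube t) (*-monoʳ-≤ 3 y³≤3ᵇ)

*-cube-bound : ∀ x y a b → x ^ 3 ≤ 3 ^ a → y ^ 3 ≤ 3 ^ b → (x * y) ^ 3 ≤ 3 ^ (a + b)
*-cube-bound x y a b x³≤3ᵃ y³≤3ᵇ = begin
  (x * y) ^ 3     ≡⟨ ^-distribʳ-* x y 3 ⟩
  x ^ 3 * y ^ 3   ≤⟨ *-mono-≤ x³≤3ᵃ y³≤3ᵇ ⟩
  3 ^ a * 3 ^ b   ≡⟨ ^-distribˡ-+-* 3 a b ⟨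
  3 ^ (a + b)     ∎
  where open ≤-Reasoning

m+n≤m*n : ∀ {m n} → 2 ≤ m → 2 ≤ n → m + n ≤ m * n
m+n≤m*n {suc (suc x)} {suc (suc y)} (s≤s (s≤s _)) (s≤s (s≤s _)) =
  ≤-trans (m≤m+n _ (x + y + x * y)) (≤-reflexive (sym (expand x y)))
  where
  expand : ∀ x y → (2 + x) * (2 + y) ≡ (2 + x) + (2 + y) + (x + y + x * y)
  expand = solve-∀

-- Unless a summand is 1, x + y ≤ x * y reduces this to *-cube-bound.
+-cube-bound : ∀ {x y a b} → 1 ≤ x → 1 ≤ y → 1 ≤ a → 1 ≤ b →
               x ^ 3 ≤ 3 ^ a → y ^ 3 ≤ 3 ^ b → (x + y) ^ 3 ≤ 3 ^ (a + b)
+-cube-bound {1} {y} {a} {b} _ 1≤y 1≤a 1≤b _ y³≤3ᵇ =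
  ≤-trans (suc-cube-bound 1≤y 1≤b y³≤3ᵇ) (^-monoʳ-≤ 3 (+-monoˡ-≤ b 1≤a))
+-cube-bound {suc (suc x)} {1} {a} {b} _ _ 1≤a 1≤b x³≤3ᵃ _ =
  subst₂ (λ u v → u ^ 3 ≤ 3 ^ v) (+-comm 1 (2 + x)) (+-comm b a)
    (+-cube-bound {1} {2 + x} {b} {a} (s≤s z≤n) (s≤s z≤n) 1≤b 1≤a (^-monoʳ-≤ 3 (z≤n {b})) x³≤3ᵃ)
+-cube-bound {suc (suc x)} {suc (suc y)} {a} {b} _ _ _ _ x³≤3ᵃ y³≤3ᵇ =
  ≤-trans (^-monoˡ-≤ 3 (m+n≤m*n {2 + x} {2 + y} (s≤s (s≤s z≤n)) (s≤s (s≤s z≤n))))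
          (*-cube-bound (2 + x) (2 + y) a b x³≤3ᵃ y³≤3ᵇ)

cube-eval≤3^ones : ∀ e → eval e ^ 3 ≤ 3 ^ ones e
cube-eval≤3^ones one     = s≤s z≤n
cube-eval≤3^ones (e ⊕ f) = +-cube-bound (1≤eval e) (1≤eval f) (1≤ones e) (1≤ones f)
                             (cube-eval≤3^ones e) (cube-eval≤3^ones f)
cube-eval≤3^ones (e ⊛ f) = *-cube-bound (eval e) (eval f) (ones e) (ones f)
                             (cube-eval≤3^ones e) (cube-eval≤3^ones f)

CpxLE⇒1≤ : ∀ {c D} → CpxLE c D → 1 ≤ D
CpxLE⇒1≤ (_ , ((e , _ , ones-e≡c) , _) , c≤D) =
  ≤-trans (1≤ones e) (≤-trans (≤-reflexive ones-e≡c) c≤D)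

lowDefect⇒lead-expr : ∀ {n f C} → LowDefect n f C → Σ Expr λ e → eval e ≡ lead f × ones e + n ≤ C
lowDefect⇒lead-expr (ld-const k C (_ , ((e , e↦k , ones-e≡c) , _) , c≤C)) =
  e , e↦k , ≤-trans (≤-reflexive (trans (+-identityʳ (ones e)) ones-e≡c)) c≤C
lowDefect⇒lead-expr (ld-tensor {n} {m} p q)
  with e₁ , e₁↦a₁ , cheap₁ ← lowDefect⇒lead-expr p
     | e₂ , e₂↦a₂ , cheap₂ ← lowDefect⇒lead-expr q =
  e₁ ⊛ e₂ , cong₂ _*_ e₁↦a₁ e₂↦a₂ ,
  ≤-trans (≤-reflexive (+-interchange (ones e₁) (ones e₂) n m)) (+-mono-≤ cheap₁ cheap₂)
lowDefect⇒lead-expr (ld-add {n} c D p cpx-c)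
  with e , e↦a , cheap ← lowDefect⇒lead-expr p =
  e , e↦a , ≤-trans (≤-reflexive (trans (+-suc (ones e) n) (+-comm 1 (ones e + n))))
                      (+-mono-≤ cheap (CpxLE⇒1≤ cpx-c))

mdeg-full : ∀ n → mdeg {n} (λ _ → true) ≡ n
mdeg-full zero    = refl
mdeg-full (suc n) = cong suc (mdeg-full n)

mdeg≤ : ∀ {n} (m : Mono n) → mdeg m ≤ n
mdeg≤ {zero}  m = z≤n
mdeg≤ {suc n} m with m Fin.zero
... | true  = s≤s (mdeg≤ (m ∘ Fin.suc))
... | false = m≤n⇒m≤1+n (mdeg≤ (m ∘ Fin.suc))

lead≢0⇒degree≡arity : ∀ {n} {f : MPoly n} {d} → lead f ≢ 0 → IsDegree f d → d ≡ n
lead≢0⇒degree≡arity {n} lead≢0 ((m , _ , mdeg-m≡d) , maximal) =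
  ≤-antisym (subst (_≤ n) mdeg-m≡d (mdeg≤ m)) (subst (_≤ _) (mdeg-full n) (maximal _ lead≢0))

defectBelow⇒cpx-bound : ∀ {n} {f : MPoly n} {C} → DefectBelow f C n →
                        ∀ k e → eval e ≡ 3 ^ k * lead f → 3 * k + C ≤ ones e + n
defectBelow⇒cpx-bound {n} {f} {C} below k e e↦3ᵏa =
  ≤-pred (≤-trans (^-cancelʳ-< 3 3^lhs<3^rhs) (≤-reflexive (+-suc (ones e) n)))
  where
  open ≤-Reasoning
  a = lead f
  [3^k]^3≡3^3k : (3 ^ k) ^ 3 ≡ 3 ^ (3 * k)
  [3^k]^3≡3^3k = trans (^-*-assoc 3 k 3) (cong (3 ^_) (*-comm k 3))
  3^lhs<3^rhs : 3 ^ (3 * k + C) < 3 ^ (ones e + suc n)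
  3^lhs<3^rhs = begin-strict
    3 ^ (3 * k + C)                 ≡⟨ ^-distribˡ-+-* 3 (3 * k) C ⟩
    3 ^ (3 * k) * 3 ^ C             <⟨ *-monoʳ-< (3 ^ (3 * k)) {{m^n≢0 3 (3 * k)}} below ⟩
    3 ^ (3 * k) * (a ^ 3 * 3 ^ suc n) ≡⟨ *-assoc (3 ^ (3 * k)) (a ^ 3) (3 ^ suc n) ⟨
    3 ^ (3 * k) * a ^ 3 * 3 ^ suc n ≡⟨ cong (λ t → t * a ^ 3 * 3 ^ suc n) [3^k]^3≡3^3k ⟨
    (3 ^ k) ^ 3 * a ^ 3 * 3 ^ suc n ≡⟨ cong (_* 3 ^ suc n) (^-distribʳ-* (3 ^ k) a 3) ⟨
    (3 ^ k * a) ^ 3 * 3 ^ suc n     ≡⟨ cong (λ t → t ^ 3 * 3 ^ suc n) e↦3ᵏa ⟨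
    eval e ^ 3 * 3 ^ suc n          ≤⟨ *-monoˡ-≤ (3 ^ suc n) (cube-eval≤3^ones e) ⟩
    3 ^ ones e * 3 ^ suc n          ≡⟨ ^-distribˡ-+-* 3 (ones e) (suc n) ⟨
    3 ^ (ones e + suc n)            ∎

three : Expr
three = (one ⊕ one) ⊕ one

expr-3^* : ∀ k e → Σ Expr λ e′ → eval e′ ≡ 3 ^ k * eval e × ones e′ ≡ 3 * k + ones e
expr-3^* zero    e = e , sym (*-identityˡ (eval e)) , refl
expr-3^* (suc k) e with e′ , e′↦3ᵏa , ones-e′ ← expr-3^* k e =
  three ⊛ e′ ,
  trans (cong (3 *_) e′↦3ᵏa) (sym (*-assoc 3 (3 ^ k) (eval e))) ,
  trans (cong (3 +_) ones-e′) (trans (sym (+-assoc 3 (3 * k) (ones e)))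
                                     (cong (_+ ones e) (sym (*-suc 3 k))))

optimal-under-3^⇒isStCpx : ∀ e → (∀ k e′ → eval e′ ≡ 3 ^ k * eval e → 3 * k + ones e ≤ ones e′) →
                              IsStCpx (eval e) (ones e)
optimal-under-3^⇒isStCpx e optimal =
  0 , subst Stable 1*a≡a stable , subst (IsCpx (3 ^ 0 * a)) (sym (+-identityʳ (ones e))) (cpx 0)
  where
  a = eval e
  1*a≡a : a ≡ 3 ^ 0 * a
  1*a≡a = sym (*-identityˡ a)
  cpx : ∀ k → IsCpx (3 ^ k * a) (3 * k + ones e)
  cpx k = expr-3^* k e , optimal k
  stable : Stable a
  stable k c ((e′ , e′↦a , ones-e′≡c) , c-minimal) =
    subst (λ c → IsCpx (3 ^ k * a) (3 * k + c)) ones-e≡c (cpx k)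
    where
    ones-e≡c : ones e ≡ c
    ones-e≡c = ≤-antisym (subst (ones e ≤_) ones-e′≡c (optimal 0 e′ (trans e′↦a 1*a≡a))) (c-minimal e refl)

proposition3p4 : ∀ (n : ℕ) (f : MPoly n) (C d : ℕ) → LowDefect n f C → IsDegree f d → DefectBelow f C d → Substantial f C d
proposition3p4 n f C d ld deg below with e , e↦a , cheap ← lowDefect⇒lead-expr ld =
  ones e , subst (λ a → IsStCpx a (ones e)) e↦a (optimal-under-3^⇒isStCpx e optimal) , C≡s+d
  where
  d≡n : d ≡ n
  d≡n = lead≢0⇒degree≡arity (m<n⇒n≢0 (subst (1 ≤_) e↦a (1≤eval e))) deg
  bound : ∀ k e′ → eval e′ ≡ 3 ^ k * eval e → 3 * k + C ≤ ones e′ + n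
  bound k e′ e′↦3ᵏa =
    defectBelow⇒cpx-bound {f = f} (subst (DefectBelow f C) d≡n below) k e′
                          (trans e′↦3ᵏa (cong (3 ^ k *_) e↦a))
  optimal : ∀ k e′ → eval e′ ≡ 3 ^ k * eval e → 3 * k + ones e ≤ ones e′
  optimal k e′ e′↦3ᵏa = +-cancelʳ-≤ n (3 * k + ones e) (ones e′)
    (≤-trans (≤-reflexive (+-assoc (3 * k) (ones e) n))
             (≤-trans (+-monoʳ-≤ (3 * k) cheap) (bound k e′ e′↦3ᵏa)))
  C≡s+d : C ≡ ones e + d
  C≡s+d = trans (≤-antisym (bound 0 e (sym (*-identityˡ (eval e)))) cheap) (cong (ones e +_) (sym d≡n))
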